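{- Let $\pi\in S_n$. Then $\mathrm{psb}(\mathrm{bub}(\pi))=12\cdots n$ if and only if $\pi\in\mathrm{Av}(2341,2431,3241,4231,45213,54213)$.
   Context: $\mathrm{Av}(T)$ is the set of permutations avoiding every pattern in $T$. $\mathrm{bub}(\pi)$ is the result of a single pass of Bubblesort on $\pi=\pi_1\cdots\pi_n$: for $i=1,\dots,n-1$ in order, if the entry currently in position $i$ is larger than the entry currently in position $i+1$, swap them. The algorithm PSB processes $\tau=\tau_1\cdots\tau_n$ from left to right with one pop stack $S$ (initially empty; PUSH puts an element on top, POP removes all elements appending them to the output from top to bottom) and an initially empty output: for $i=1,\dots,n$, if $S$ is empty or $\tau_i=\mathrm{TOP}(S)-1$ (where $\mathrm{TOP}(S)$ is the top element of $S$), push $\tau_i$; else if $\tau_i<\mathrm{TOP}(S)-1$, append $\tau_i$ directly to the output (bypass); otherwise pop $S$ and then push $\tau_i$. After all entries are processed, pop $S$; the output is $\mathrm{psb}(\tau)$. -}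

module Defs where

open import Data.Nat using (ℕ; zero; suc; _<_; _<ᵇ_; _≡ᵇ_)
open import Data.Bool using (Bool; true; false; if_then_else_)
open import Data.List using (List; []; _∷_; _++_; reverse; map; upTo; length)
open import Data.List.Relation.Binary.Pointwise using (Pointwise)
open import Data.List.Relation.Binary.Permutation.Propositional using (_↭_)
open import Data.List.Relation.Binary.Sublist.Propositional using (_⊆_)
open import Data.List.Relation.Unary.All using (All)
open import Data.Product using (Σ; _×_; ∃-syntax)
open import Data.Unit using (⊤)
open import Data.Empty using (⊥)
open import Function.Bundles using (_⇔_)
open import Relation.Nullary using (¬_)

-- Permutations are lists of the values 1..n (one-line notation).
idPerm : ℕ → List ℕ
idPerm n = map suc (upTo n)

IsPerm : ℕ → List ℕ → Set
IsPerm n π = π ↭ idPerm n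

OrdIso : List ℕ → List ℕ → Set
OrdIso [] [] = ⊤
OrdIso [] (_ ∷ _) = ⊥
OrdIso (_ ∷ _) [] = ⊥
OrdIso (x ∷ xs) (p ∷ ps) =
  Pointwise (λ y q → (x < y ⇔ p < q) × (y < x ⇔ q < p)) xs ps × OrdIso xs ps

Contains : List ℕ → List ℕ → Set
Contains π σ = ∃[ τ ] (τ ⊆ π × OrdIso τ σ)

Avoids : List (List ℕ) → List ℕ → Set
Avoids T π = All (λ σ → ¬ Contains π σ) T

-- One pass of Bubblesort: carry the current (running) entry to the right.
bubAux : ℕ → List ℕ → List ℕ
bubAux x [] = x ∷ []
bubAux x (y ∷ ys) = if y <ᵇ x then y ∷ bubAux x ys else x ∷ bubAux y ys

bub : List ℕ → List ℕ
bub [] = []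
bub (x ∷ xs) = bubAux x xs

-- PSB. The stack is a list with its top at the head; the output is kept reversed.
-- POP appends the stack elements from top to bottom to the output.
popAll : List ℕ → List ℕ → List ℕ
popAll [] out = out
popAll (s ∷ st) out = popAll st (s ∷ out)

psbAux : List ℕ → List ℕ → List ℕ → List ℕ
psbAux [] st out = reverse (popAll st out)
psbAux (t ∷ ts) [] out = psbAux ts (t ∷ []) out
psbAux (t ∷ ts) (s ∷ st) out =
  if suc t ≡ᵇ s then psbAux ts (t ∷ s ∷ st) out
  else if suc t <ᵇ s then psbAux ts (s ∷ st) (t ∷ out)
  else psbAux ts (t ∷ []) (popAll (s ∷ st) out)

psb : List ℕ → List ℕ
psb τ = psbAux τ [] []

-- A single Bubblesort pass carries the running maximum c of the prefix P read so far: an entry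
-- x < c is emitted at once, otherwise c is emitted and x is carried on.  Run PSB in lockstep on
-- what Bubblesort emits.  While PSB has produced 1, …, m correctly, its stack is a run
-- b, b+1, …, b+k−1 with b on top, and P is exactly {1, …, m} ∪ [b, b+k) ∪ {c}.  An emitted entry
-- extending the run is pushed; the entry m+1 bypasses the stack; anything else pops it, which is
-- harmless exactly when b = m+1.  Each way of going wrong exhibits a blocked entry x of π: two
-- earlier entries β < γ together with either a later α < β where β < x, or later α before ε with
-- α < x < ε < β; conversely no blocked entry is ever met on a successful run.  A blocked entry
-- is the third entry of an occurrence of one of the six patterns, and every occurrence arises so.
module Submission where

open import Defs
open import Data.Bool using (true; false; T)
open import Data.Bool.Properties using (T-≡; ¬-not)
open import Data.Empty using (⊥; ⊥-elim)
open import Data.Nat using (ℕ; zero; suc; _+_; _≤_; _<_; _<ᵇ_; _≡ᵇ_; z≤n; s≤s)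
open import Data.Nat.Properties
open import Data.List using (List; []; _∷_; _++_; [_]; reverse; applyUpTo; _ʳ++_)
open import Data.List.Properties
  using (∷-injective; ++-assoc; ++-identityʳ; reverse-++; unfold-reverse; map-applyUpTo; ʳ++-defn)
open import Data.List.Membership.Propositional using (_∈_; _∉_)
open import Data.List.Membership.Propositional.Properties
  using (∈-++⁺ˡ; ∈-++⁺ʳ; ∈-++⁻; ∈-map⁺; ∈-map⁻; ∈-upTo⁺; ∈-upTo⁻)
open import Data.List.Relation.Unary.Any using (here; there)
open import Data.List.Relation.Unary.All as All using ([]; _∷_)
open import Data.List.Relation.Unary.AllPairs using (_∷_)
open import Data.List.Relation.Unary.Unique.Propositional using (Unique)
import Data.List.Relation.Unary.Unique.Propositional.Properties as Unique
open import Data.List.Relation.Binary.Pointwise using ([]; _∷_)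
open import Data.List.Relation.Binary.Sublist.Propositional using (_⊆_; []; _∷_; _∷ʳ_; from∈; lookup; minimum)
open import Data.List.Relation.Binary.Sublist.Propositional.Properties using (++⁺)
open import Data.List.Relation.Binary.Permutation.Propositional using (↭-sym; ↭⇒↭ₛ)
open import Data.List.Relation.Binary.Permutation.Propositional.Properties using (∈-resp-↭)
open import Data.List.Relation.Binary.Permutation.Setoid.Properties using (Unique-resp-↭)
open import Data.Product using (_×_; _,_; proj₁; proj₂; ∃-syntax)
open import Data.Sum using (_⊎_; inj₁; inj₂; [_,_]′)
open import Function using (id; _∘_; _⇔_; mk⇔; Equivalence)
open import Function.Properties.Equivalence using () renaming (trans to ⇔-trans)
open import Relation.Nullary using (¬_; yes; no)
open import Relation.Binary.Definitions using (tri<; tri≈; tri>)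
open import Relation.Binary.PropositionalEquality
  using (_≡_; _≢_; refl; sym; trans; cong; cong₂; subst; setoid; module ≡-Reasoning)

∈-++-∷⁻ : ∀ P {x R} {v : ℕ} → v ∈ P ++ x ∷ R → v ∈ P ⊎ v ≡ x ⊎ v ∈ R
∈-++-∷⁻ P v∈ with ∈-++⁻ P v∈
... | inj₁ v∈P         = inj₁ v∈P
... | inj₂ (here v≡x)  = inj₂ (inj₁ v≡x)
... | inj₂ (there v∈R) = inj₂ (inj₂ v∈R)

∈-∷ʳ⁻ : ∀ P {x} {v : ℕ} → v ∈ P ++ [ x ] → v ∈ P ⊎ v ≡ x
∈-∷ʳ⁻ P v∈ with ∈-++-∷⁻ P v∈
... | inj₁ v∈P        = inj₁ v∈P
... | inj₂ (inj₁ v≡x) = inj₂ v≡x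

Unique-++-disjoint : ∀ P {Q : List ℕ} {v} → Unique (P ++ Q) → v ∈ P → v ∉ Q
Unique-++-disjoint (p ∷ P) (p∉ ∷ _) (here refl) v∈Q = All.lookup p∉ (∈-++⁺ʳ P v∈Q) refl
Unique-++-disjoint (p ∷ P) (_ ∷ u)  (there v∈P) = Unique-++-disjoint P u v∈P

run : ℕ → ℕ → List ℕ
run s zero    = []
run s (suc k) = s ∷ run (suc s) k

down : ℕ → List ℕ
down zero    = []
down (suc m) = suc m ∷ down m

applyUpTo-run : ∀ (f : ℕ → ℕ) s n → (∀ i → f i ≡ s + i) → applyUpTo f n ≡ run s n
applyUpTo-run f s zero    f≗ = refl
applyUpTo-run f s (suc n) f≗ = cong₂ _∷_ (trans (f≗ 0) (+-identityʳ s))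
  (applyUpTo-run (f ∘ suc) (suc s) n (λ i → trans (f≗ (suc i)) (+-suc s i)))

idPerm-run : ∀ n → idPerm n ≡ run 1 n
idPerm-run n = trans (map-applyUpTo id suc n) (applyUpTo-run suc 1 n (λ _ → refl))

run-∷ʳ : ∀ s m → run s m ++ [ s + m ] ≡ run s (suc m)
run-∷ʳ s zero    = cong [_] (+-identityʳ s)
run-∷ʳ s (suc m) = cong (s ∷_) (trans (cong (λ z → run (suc s) m ++ [ z ]) (+-suc s m)) (run-∷ʳ (suc s) m))

reverse-down : ∀ m → reverse (down m) ≡ run 1 m
reverse-down zero    = refl
reverse-down (suc m) = begin
  reverse (suc m ∷ down m)      ≡⟨ unfold-reverse (suc m) (down m) ⟩
  reverse (down m) ++ [ suc m ] ≡⟨ cong (_++ [ suc m ]) (reverse-down m) ⟩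
  run 1 m ++ [ suc m ]          ≡⟨ run-∷ʳ 1 m ⟩
  run 1 (suc m)                 ∎
  where open ≡-Reasoning

run-++-∷ : ∀ s m n {x} Y → run s m ++ x ∷ Y ≡ run s n → x ≡ s + m
run-++-∷ s zero    (suc n) Y eq = trans (proj₁ (∷-injective eq)) (sym (+-identityʳ s))
run-++-∷ s (suc m) (suc n) Y eq = trans (run-++-∷ (suc s) m n Y (proj₂ (∷-injective eq))) (sym (+-suc s m))

≡ᵇ-false : ∀ {m n} → m ≢ n → (m ≡ᵇ n) ≡ false
≡ᵇ-false {m} {n} m≢n = ¬-not (m≢n ∘ ≡ᵇ⇒≡ m n ∘ Equivalence.from T-≡)

<ᵇ-false : ∀ {m n} → n ≤ m → (m <ᵇ n) ≡ false
<ᵇ-false {m} {n} n≤m = ¬-not (λ m<ᵇn → <⇒≱ (<ᵇ⇒< m n (Equivalence.from T-≡ m<ᵇn)) n≤m)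

<ᵇ-true : ∀ {m n} → m < n → (m <ᵇ n) ≡ true
<ᵇ-true = Equivalence.to T-≡ ∘ <⇒<ᵇ

bubAux-< : ∀ {x c} R → x < c → bubAux c (x ∷ R) ≡ x ∷ bubAux c R
bubAux-< R x<c rewrite <ᵇ-true x<c = refl

bubAux-≥ : ∀ {x c} R → c ≤ x → bubAux c (x ∷ R) ≡ c ∷ bubAux x R
bubAux-≥ R c≤x rewrite <ᵇ-false c≤x = refl

popAll-ʳ++ : ∀ st out → popAll st out ≡ st ʳ++ out
popAll-ʳ++ []       out = refl
popAll-ʳ++ (s ∷ st) out = popAll-ʳ++ st (s ∷ out)

popAll-reverse : ∀ st out → popAll st out ≡ reverse st ++ out
popAll-reverse st out = trans (popAll-ʳ++ st out) (ʳ++-defn st)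

popAll-run : ∀ j m → popAll (run (suc m) j) (down m) ≡ down (m + j)
popAll-run zero    m = cong down (sym (+-identityʳ m))
popAll-run (suc j) m = trans (popAll-run j (suc m)) (cong down (sym (+-suc m j)))

psbAux-push : ∀ t ts st out → psbAux (t ∷ ts) (suc t ∷ st) out ≡ psbAux ts (t ∷ suc t ∷ st) out
psbAux-push t ts st out rewrite Equivalence.to T-≡ (≡⇒≡ᵇ t t refl) = refl

psbAux-bypass : ∀ {t s} ts st out → suc t < s → psbAux (t ∷ ts) (s ∷ st) out ≡ psbAux ts (s ∷ st) (t ∷ out)
psbAux-bypass ts st out t<s rewrite ≡ᵇ-false (<⇒≢ t<s) | <ᵇ-true t<s = refl

psbAux-pop : ∀ {t s} ts st out → s ≤ t → psbAux (t ∷ ts) (s ∷ st) out ≡ psbAux ts [ t ] (popAll (s ∷ st) out)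
psbAux-pop ts st out s≤t rewrite ≡ᵇ-false (>⇒≢ (s≤s s≤t)) | <ᵇ-false (m≤n⇒m≤1+n s≤t) = refl

extends-prefix : ∀ {L : List ℕ} Z out → ∃[ Y ] L ≡ reverse (Z ++ out) ++ Y → ∃[ Y ] L ≡ reverse out ++ Y
extends-prefix Z out (Y , eq) =
  reverse Z ++ Y , trans eq (trans (cong (_++ Y) (reverse-++ Z out)) (++-assoc (reverse out) (reverse Z) Y))

psbAux-flush : ∀ {t} ts k m → suc m ≤ t →
               psbAux (t ∷ ts) (run (suc m) (suc k)) (down m) ≡ psbAux (t ∷ ts) [] (down (m + suc k))
psbAux-flush {t} ts k m 1+m≤t =
  trans (psbAux-pop ts (run (suc (suc m)) k) (down m) 1+m≤t) (cong (psbAux ts [ t ]) (popAll-run (suc k) m))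

psbAux-extends : ∀ ts st out → ∃[ Y ] psbAux ts st out ≡ reverse out ++ Y
psbAux-extends [] st out = extends-prefix (reverse st) out
  ([] , trans (cong reverse (popAll-reverse st out)) (sym (++-identityʳ _)))
psbAux-extends (t ∷ ts) [] out = psbAux-extends ts [ t ] out
psbAux-extends (t ∷ ts) (s ∷ st) out with suc t ≡ᵇ s | suc t <ᵇ s
... | true  | _     = psbAux-extends ts (t ∷ s ∷ st) out
... | false | true  = extends-prefix [ t ] out (psbAux-extends ts (s ∷ st) (t ∷ out))
... | false | false with psbAux-extends ts [ t ] (popAll (s ∷ st) out)
...   | Y , eq = extends-prefix (reverse (s ∷ st)) out
  (Y , trans eq (cong (λ o → reverse o ++ Y) (popAll-reverse (s ∷ st) out)))

psbAux-next-output : ∀ ts st Z {y} m n → psbAux ts st (Z ++ y ∷ down m) ≡ idPerm n → y ≡ suc m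
psbAux-next-output ts st Z {y} m n eq
  with extends-prefix Z (y ∷ down m) (psbAux-extends ts st (Z ++ y ∷ down m))
... | Y , ext = run-++-∷ 1 m n Y (begin
  run 1 m ++ y ∷ Y                 ≡⟨ ++-assoc (run 1 m) [ y ] Y ⟨
  (run 1 m ++ [ y ]) ++ Y          ≡⟨ cong (λ r → (r ++ [ y ]) ++ Y) (reverse-down m) ⟨
  (reverse (down m) ++ [ y ]) ++ Y ≡⟨ cong (_++ Y) (unfold-reverse y (down m)) ⟨
  reverse (y ∷ down m) ++ Y        ≡⟨ ext ⟨
  psbAux ts st (Z ++ y ∷ down m)   ≡⟨ eq ⟩
  idPerm n                         ≡⟨ idPerm-run n ⟩
  run 1 n                          ∎)
  where open ≡-Reasoning

-- Blocked entries

Precedes : ℕ → ℕ → List ℕ → Set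
Precedes u w L = ∃[ A ] ∃[ B ] (L ≡ A ++ u ∷ B × w ∈ B)

precedes-or-follows : ∀ {u w} L → u ∈ L → w ∈ L → u ≢ w → Precedes u w L ⊎ Precedes w u L
precedes-or-follows (y ∷ L) (here refl) (here refl) u≢w = ⊥-elim (u≢w refl)
precedes-or-follows (y ∷ L) (here refl) (there w∈L) _   = inj₁ ([] , L , refl , w∈L)
precedes-or-follows (y ∷ L) (there u∈L) (here refl) _   = inj₂ ([] , L , refl , u∈L)
precedes-or-follows (y ∷ L) (there u∈L) (there w∈L) u≢w with precedes-or-follows L u∈L w∈L u≢w
... | inj₁ (A , B , eq , w∈B) = inj₁ (y ∷ A , B , cong (y ∷_) eq , w∈B)
... | inj₂ (A , B , eq , u∈B) = inj₂ (y ∷ A , B , cong (y ∷_) eq , u∈B)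

Precedes⇒∈ : ∀ {u w L} → Precedes u w L → u ∈ L × w ∈ L
Precedes⇒∈ (A , B , refl , w∈B) = ∈-++⁺ʳ A (here refl) , ∈-++⁺ʳ A (there w∈B)

-- x is blocked when it is the third entry of an occurrence β γ x α or γ β x α of 2341, 2431,
-- 3241, 4231 (Blocked₄), or β γ x α ε or γ β x α ε of 45213, 54213 (Blocked₅).
Blocked₄ : List ℕ → ℕ → List ℕ → Set
Blocked₄ P x R = ∃[ β ] ∃[ γ ] ∃[ α ] (β ∈ P × γ ∈ P × β < γ × β < x × α ∈ R × α < β)

Blocked₅ : List ℕ → ℕ → List ℕ → Set
Blocked₅ P x R = ∃[ β ] ∃[ γ ] ∃[ α ] ∃[ ε ]
  (β ∈ P × γ ∈ P × β < γ × Precedes α ε R × α < x × x < ε × ε < β)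

Blocked : List ℕ → ℕ → List ℕ → Set
Blocked P x R = Blocked₄ P x R ⊎ Blocked₅ P x R

Blocked⇒descent : ∀ {P x R} → Blocked P x R → ∃[ β ] ∃[ γ ] ∃[ α ] (β ∈ P × γ ∈ P × β < γ × α ∈ R × α < β)
Blocked⇒descent (inj₁ (β , γ , α , β∈P , γ∈P , β<γ , _ , α∈R , α<β)) = β , γ , α , β∈P , γ∈P , β<γ , α∈R , α<β
Blocked⇒descent (inj₂ (β , γ , α , ε , β∈P , γ∈P , β<γ , α≺ε , α<x , x<ε , ε<β)) =
  β , γ , α , β∈P , γ∈P , β<γ , proj₁ (Precedes⇒∈ α≺ε) , <-trans α<x (<-trans x<ε ε<β)

Unblocked : List ℕ → List ℕ → Set
Unblocked P R = ∀ R₁ x R₂ → R ≡ R₁ ++ x ∷ R₂ → ¬ Blocked (P ++ R₁) x R₂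

Unblocked-[] : ∀ P → Unblocked P []
Unblocked-[] P []      _ _ ()
Unblocked-[] P (_ ∷ _) _ _ ()

¬Blocked-[] : ∀ {x R} → ¬ Blocked [] x R
¬Blocked-[] (inj₁ (_ , _ , _ , () , _))
¬Blocked-[] (inj₂ (_ , _ , _ , _ , () , _))

Unblocked⇒¬Blocked : ∀ {P x R} → Unblocked P (x ∷ R) → ¬ Blocked P x R
Unblocked⇒¬Blocked {P} {x} {R} unblocked =
  unblocked [] x R refl ∘ subst (λ Q → Blocked Q x R) (sym (++-identityʳ P))

Unblocked-∷ : ∀ {P x R} → ¬ Blocked P x R → Unblocked (P ++ [ x ]) R ⇔ Unblocked P (x ∷ R)
Unblocked-∷ {P} {x} {R} ¬blocked = mk⇔ cons tail
  where
  cons : Unblocked (P ++ [ x ]) R → Unblocked P (x ∷ R)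
  cons unblocked []       y R₂ refl = ¬blocked ∘ subst (λ Q → Blocked Q y R₂) (++-identityʳ P)
  cons unblocked (y ∷ R₁) z R₂ refl =
    unblocked R₁ z R₂ refl ∘ subst (λ Q → Blocked Q z R₂) (sym (++-assoc P [ y ] R₁))
  tail : Unblocked P (x ∷ R) → Unblocked (P ++ [ x ]) R
  tail unblocked R₁ y R₂ eq =
    unblocked (x ∷ R₁) y R₂ (cong (x ∷_) eq) ∘ subst (λ Q → Blocked Q y R₂) (++-assoc P [ x ] R₁)

empty-run : ∀ {b v} → b ≤ v → v < b + 0 → ⊥
empty-run {b} b≤v v<b+0 = <⇒≱ v<b+0 (subst (_≤ _) (sym (+-identityʳ b)) b≤v)

singleton-run : ∀ {b v} → b ≤ v → v < b + 1 → v ≡ b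
singleton-run {b} {v} b≤v v<b+1 = ≤-antisym (m<1+n⇒m≤n (subst (v <_) (+-comm b 1) v<b+1)) b≤v

∈-singleton-run : ∀ b → b ≤ b × b < b + 1
∈-singleton-run b = ≤-refl , m<m+n b (s≤s z≤n)

-- Bubblesort has read the prefix P and carries c = max P; the PSB stack is run b k (top b) and
-- PSB has output 1, …, m, which it stores reversed as down m.
record Invariant (P : List ℕ) (c b k m : ℕ) : Set where
  field
    max∈     : c ∈ P
    m<b      : m < b
    b+k≤c    : b + k ≤ c
    output⊆  : ∀ {v} → 0 < v → v ≤ m → v ∈ P
    run⊆     : ∀ {v} → b ≤ v → v < b + k → v ∈ P
    classify : ∀ {v} → v ∈ P → v ≤ m ⊎ (b ≤ v × v < b + k) ⊎ v ≡ c

  b≤c : b ≤ c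
  b≤c = ≤-trans (m≤m+n b k) b+k≤c

  m<c : m < c
  m<c = <-≤-trans m<b b≤c

  ≤max : ∀ {v} → v ∈ P → v ≤ c
  ≤max v∈P with classify v∈P
  ... | inj₁ v≤m                = ≤-trans v≤m (<⇒≤ m<c)
  ... | inj₂ (inj₁ (_ , v<b+k)) = <⇒≤ (<-≤-trans v<b+k b+k≤c)
  ... | inj₂ (inj₂ refl)        = ≤-refl

module _ {P c b k m} (I : Invariant P c b k m) where
  open Invariant I

  ∉-Invariant : ∀ {v} → m < v → v < b ⊎ b + k ≤ v → v ≢ c → v ∉ P
  ∉-Invariant m<v outside v≢c v∈P with classify v∈P | outside
  ... | inj₁ v≤m                | _          = <⇒≱ m<v v≤m
  ... | inj₂ (inj₂ v≡c)         | _          = v≢c v≡c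
  ... | inj₂ (inj₁ (b≤v , _))   | inj₁ v<b   = <⇒≱ v<b b≤v
  ... | inj₂ (inj₁ (_ , v<b+k)) | inj₂ b+k≤v = <⇒≱ v<b+k b+k≤v

  descent-in-run : ∀ {β γ α} → β ∈ P → γ ∈ P → β < γ → α ∉ P → 0 < α → α < β →
                   (b ≤ β × β < b + k) × m < α × α < b
  descent-in-run {β} {γ} {α} β∈P γ∈P β<γ α∉P 0<α α<β with classify β∈P
  ... | inj₁ β≤m                  = ⊥-elim (α∉P (output⊆ 0<α (<⇒≤ (<-≤-trans α<β β≤m))))
  ... | inj₂ (inj₂ refl)          = ⊥-elim (<⇒≱ β<γ (≤max γ∈P))
  ... | inj₂ (inj₁ (b≤β , β<b+k)) = (b≤β , β<b+k) , m<α , α<b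
    where
    m<α : m < α
    m<α = ≰⇒> (α∉P ∘ output⊆ 0<α)
    α<b : α < b
    α<b = ≰⇒> (λ b≤α → α∉P (run⊆ b≤α (<-trans α<β β<b+k)))

fresh⇒above-output : ∀ {P c b k m v} → Invariant P c b k m → v ∉ P → 0 < v → m < v
fresh⇒above-output I v∉P 0<v = ≰⇒> (v∉P ∘ Invariant.output⊆ I 0<v)

Invariant-start : ∀ {c} → 0 < c → Invariant [ c ] c c 0 0
Invariant-start {c} 0<c = record
  { max∈     = here refl
  ; m<b      = 0<c
  ; b+k≤c    = ≤-reflexive (+-identityʳ c)
  ; output⊆  = λ 0<v v≤0 → ⊥-elim (<⇒≱ 0<v v≤0)
  ; run⊆     = λ c≤v v<c+0 → ⊥-elim (empty-run c≤v v<c+0)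
  ; classify = λ { (here refl) → inj₂ (inj₂ refl) }
  }

Invariant-relocate : ∀ {P c b m b′} → Invariant P c b 0 m → m < b′ → b′ ≤ c → Invariant P c b′ 0 m
Invariant-relocate {P} {c} {b} {m} {b′} I m<b′ b′≤c = record
  { max∈     = max∈
  ; m<b      = m<b′
  ; b+k≤c    = subst (_≤ c) (sym (+-identityʳ b′)) b′≤c
  ; output⊆  = output⊆
  ; run⊆     = λ b′≤v v<b′+0 → ⊥-elim (empty-run b′≤v v<b′+0)
  ; classify = reclassify ∘ classify
  }
  where
  open Invariant I
  reclassify : ∀ {v} → v ≤ m ⊎ (b ≤ v × v < b + 0) ⊎ v ≡ c → v ≤ m ⊎ (b′ ≤ v × v < b′ + 0) ⊎ v ≡ c
  reclassify (inj₁ v≤m)                  = inj₁ v≤m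
  reclassify (inj₂ (inj₁ (b≤v , v<b+0))) = ⊥-elim (empty-run b≤v v<b+0)
  reclassify (inj₂ (inj₂ v≡c))           = inj₂ (inj₂ v≡c)

Invariant-push : ∀ {P c x k m} → Invariant P c (suc x) k m → m < x → Invariant (P ++ [ x ]) c x (suc k) m
Invariant-push {P} {c} {x} {k} {m} I m<x = record
  { max∈     = ∈-++⁺ˡ max∈
  ; m<b      = m<x
  ; b+k≤c    = subst (_≤ c) (sym (+-suc x k)) b+k≤c
  ; output⊆  = λ 0<v v≤m → ∈-++⁺ˡ (output⊆ 0<v v≤m)
  ; run⊆     = run⊆′
  ; classify = classify′ ∘ ∈-∷ʳ⁻ P
  }
  where
  open Invariant I
  run⊆′ : ∀ {v} → x ≤ v → v < x + suc k → v ∈ P ++ [ x ]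
  run⊆′ {v} x≤v v<x+1+k with m≤n⇒m<n∨m≡n x≤v
  ... | inj₁ x<v  = ∈-++⁺ˡ (run⊆ x<v (subst (v <_) (+-suc x k) v<x+1+k))
  ... | inj₂ refl = ∈-++⁺ʳ P (here refl)
  classify′ : ∀ {v} → v ∈ P ⊎ v ≡ x → v ≤ m ⊎ (x ≤ v × v < x + suc k) ⊎ v ≡ c
  classify′ {v} (inj₁ v∈P) with classify v∈P
  ... | inj₁ v≤m                  = inj₁ v≤m
  ... | inj₂ (inj₁ (x<v , v<b+k)) = inj₂ (inj₁ (<⇒≤ x<v , subst (v <_) (sym (+-suc x k)) v<b+k))
  ... | inj₂ (inj₂ v≡c)           = inj₂ (inj₂ v≡c)
  classify′ (inj₂ refl) = inj₂ (inj₁ (≤-refl , m<m+n x (s≤s z≤n)))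

Invariant-bypass : ∀ {P c b k m} → Invariant P c b k m → suc m < b → Invariant (P ++ [ suc m ]) c b k (suc m)
Invariant-bypass {P} {c} {b} {k} {m} I 1+m<b = record
  { max∈     = ∈-++⁺ˡ max∈
  ; m<b      = 1+m<b
  ; b+k≤c    = b+k≤c
  ; output⊆  = output⊆′
  ; run⊆     = λ b≤v v<b+k → ∈-++⁺ˡ (run⊆ b≤v v<b+k)
  ; classify = classify′ ∘ ∈-∷ʳ⁻ P
  }
  where
  open Invariant I
  output⊆′ : ∀ {v} → 0 < v → v ≤ suc m → v ∈ P ++ [ suc m ]
  output⊆′ 0<v v≤1+m with m≤n⇒m<n∨m≡n v≤1+m
  ... | inj₁ v<1+m = ∈-++⁺ˡ (output⊆ 0<v (m<1+n⇒m≤n v<1+m))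
  ... | inj₂ refl  = ∈-++⁺ʳ P (here refl)
  classify′ : ∀ {v} → v ∈ P ⊎ v ≡ suc m → v ≤ suc m ⊎ (b ≤ v × v < b + k) ⊎ v ≡ c
  classify′ (inj₁ v∈P) with classify v∈P
  ... | inj₁ v≤m = inj₁ (m≤n⇒m≤1+n v≤m)
  ... | inj₂ v∈  = inj₂ v∈
  classify′ (inj₂ refl) = inj₁ ≤-refl

Invariant-pop : ∀ {P c k m} → Invariant P c (suc m) k m → Invariant P c c 0 (m + k)
Invariant-pop {P} {c} {k} {m} I = record
  { max∈     = max∈
  ; m<b      = b+k≤c
  ; b+k≤c    = ≤-reflexive (+-identityʳ c)
  ; output⊆  = output⊆′
  ; run⊆     = λ c≤v v<c+0 → ⊥-elim (empty-run c≤v v<c+0)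
  ; classify = classify′ ∘ classify
  }
  where
  open Invariant I
  output⊆′ : ∀ {v} → 0 < v → v ≤ m + k → v ∈ P
  output⊆′ {v} 0<v v≤m+k with v ≤? m
  ... | yes v≤m = output⊆ 0<v v≤m
  ... | no  v≰m = run⊆ (≰⇒> v≰m) (s≤s v≤m+k)
  classify′ : ∀ {v} → v ≤ m ⊎ (suc m ≤ v × v < suc m + k) ⊎ v ≡ c → v ≤ m + k ⊎ (c ≤ v × v < c + 0) ⊎ v ≡ c
  classify′ (inj₁ v≤m)             = inj₁ (≤-trans v≤m (m≤m+n m k))
  classify′ (inj₂ (inj₁ (_ , v<))) = inj₁ (m<1+n⇒m≤n v<)
  classify′ (inj₂ (inj₂ v≡c))      = inj₂ (inj₂ v≡c)

Invariant-new-max : ∀ {P c b m x} → Invariant P c b 0 m → c < x → Invariant (P ++ [ x ]) x c 1 m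
Invariant-new-max {P} {c} {b} {m} {x} I c<x = record
  { max∈     = ∈-++⁺ʳ P (here refl)
  ; m<b      = m<c
  ; b+k≤c    = subst (_≤ x) (+-comm 1 c) c<x
  ; output⊆  = λ 0<v v≤m → ∈-++⁺ˡ (output⊆ 0<v v≤m)
  ; run⊆     = λ c≤v v<c+1 → ∈-++⁺ˡ (subst (_∈ P) (sym (singleton-run c≤v v<c+1)) max∈)
  ; classify = classify′ ∘ ∈-∷ʳ⁻ P
  }
  where
  open Invariant I
  classify′ : ∀ {v} → v ∈ P ⊎ v ≡ x → v ≤ m ⊎ (c ≤ v × v < c + 1) ⊎ v ≡ x
  classify′ (inj₁ v∈P) with classify v∈P
  ... | inj₁ v≤m                  = inj₁ v≤m
  ... | inj₂ (inj₁ (b≤v , v<b+0)) = ⊥-elim (empty-run b≤v v<b+0)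
  ... | inj₂ (inj₂ refl)          = inj₂ (inj₁ (∈-singleton-run c))
  classify′ (inj₂ v≡x) = inj₂ (inj₂ v≡x)

-- The lockstep simulation

⇔-both-false : ∀ {A B : Set} → ¬ A → ¬ B → A ⇔ B
⇔-both-false ¬a ¬b = mk⇔ (⊥-elim ∘ ¬a) (⊥-elim ∘ ¬b)

module _ {n π} (π↭ : IsPerm n π) where

  IsPerm⇒Unique : Unique π
  IsPerm⇒Unique = Unique-resp-↭ (setoid ℕ) (↭⇒↭ₛ (↭-sym π↭)) (Unique.map⁺ suc-injective (Unique.upTo⁺ n))

  IsPerm⇒∈⁻ : ∀ {v} → v ∈ π → 0 < v × v ≤ n
  IsPerm⇒∈⁻ v∈π with ∈-map⁻ suc (∈-resp-↭ π↭ v∈π)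
  ... | _ , i∈ , refl = s≤s z≤n , ∈-upTo⁻ i∈

  IsPerm⇒∈⁺ : ∀ {v} → 0 < v → v ≤ n → v ∈ π
  IsPerm⇒∈⁺ {suc i} _ i<n = ∈-resp-↭ (↭-sym π↭) (∈-map⁺ suc (∈-upTo⁺ i<n))

module Simulation {n π} (π↭ : IsPerm n π) where

  ∈-prefix⇒≤n : ∀ {P R v} → π ≡ P ++ R → v ∈ P → v ≤ n
  ∈-prefix⇒≤n π≡ v∈P = proj₂ (IsPerm⇒∈⁻ π↭ (subst (_ ∈_) (sym π≡) (∈-++⁺ˡ v∈P)))

  module Split {P x R} (π≡ : π ≡ P ++ x ∷ R) where

    private
      unique : Unique (P ++ x ∷ R)
      unique = subst Unique π≡ (IsPerm⇒Unique π↭)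

      ∈⇒∈π : ∀ {v} → v ∈ P ++ x ∷ R → v ∈ π
      ∈⇒∈π = subst (_ ∈_) (sym π≡)

    x∉P : x ∉ P
    x∉P x∈P = Unique-++-disjoint P unique x∈P (here refl)

    ∈R⇒∉P : ∀ {v} → v ∈ R → v ∉ P
    ∈R⇒∉P v∈R v∈P = Unique-++-disjoint P unique v∈P (there v∈R)

    0<x : 0 < x
    0<x = proj₁ (IsPerm⇒∈⁻ π↭ (∈⇒∈π (∈-++⁺ʳ P (here refl))))

    0<∈R : ∀ {v} → v ∈ R → 0 < v
    0<∈R v∈R = proj₁ (IsPerm⇒∈⁻ π↭ (∈⇒∈π (∈-++⁺ʳ P (there v∈R))))

    ∈R : ∀ {v} → 0 < v → v ≤ n → v ∉ P → v ≢ x → v ∈ R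
    ∈R 0<v v≤n v∉P v≢x with ∈-++-∷⁻ P (subst (_ ∈_) π≡ (IsPerm⇒∈⁺ π↭ 0<v v≤n))
    ... | inj₁ v∈P        = ⊥-elim (v∉P v∈P)
    ... | inj₂ (inj₁ v≡x) = ⊥-elim (v≢x v≡x)
    ... | inj₂ (inj₂ v∈R) = v∈R

    ++-∷ʳ : π ≡ (P ++ [ x ]) ++ R
    ++-∷ʳ = trans π≡ (sym (++-assoc P [ x ] R))

    run-descent : ∀ {c b k m β γ α} → Invariant P c b k m → β ∈ P → γ ∈ P → β < γ → α ∈ R → α < β →
                  (b ≤ β × β < b + k) × m < α × α < b
    run-descent I β∈P γ∈P β<γ α∈R = descent-in-run I β∈P γ∈P β<γ (∈R⇒∉P α∈R) (0<∈R α∈R)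

  module _ {P x R} (π≡ : π ≡ P ++ x ∷ R) where
    open Split π≡

    ¬Blocked-empty-run : ∀ {c b m} → Invariant P c b 0 m → ¬ Blocked P x R
    ¬Blocked-empty-run I blocked with Blocked⇒descent blocked
    ... | β , γ , α , β∈P , γ∈P , β<γ , α∈R , α<β =
      let (b≤β , β<b+0) , _ = run-descent I β∈P γ∈P β<γ α∈R α<β in empty-run b≤β β<b+0

    ¬Blocked-push : ∀ {c k m} → Invariant P c (suc x) k m → ¬ Blocked P x R
    ¬Blocked-push I (inj₁ (β , γ , α , β∈P , γ∈P , β<γ , β<x , α∈R , α<β)) =
      let (1+x≤β , _) , _ = run-descent I β∈P γ∈P β<γ α∈R α<β in <-asym β<x 1+x≤β
    ¬Blocked-push I (inj₂ (β , γ , α , ε , β∈P , γ∈P , β<γ , α≺ε , α<x , x<ε , ε<β)) =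
      let α∈R , ε∈R = Precedes⇒∈ α≺ε
          (_ , β<b+k) , _ = run-descent I β∈P γ∈P β<γ α∈R (<-trans α<x (<-trans x<ε ε<β))
      in ∈R⇒∉P ε∈R (Invariant.run⊆ I x<ε (<-trans ε<β β<b+k))

    ¬Blocked-bypass : ∀ {c b k m} → x ≡ suc m → Invariant P c b k m → suc x < b → ¬ Blocked P x R
    ¬Blocked-bypass refl I 1+x<b (inj₁ (β , γ , α , β∈P , γ∈P , β<γ , β<x , α∈R , α<β)) =
      let (b≤β , _) , _ = run-descent I β∈P γ∈P β<γ α∈R α<β
      in <-asym (<-trans β<x (n<1+n _)) (<-≤-trans 1+x<b b≤β)
    ¬Blocked-bypass refl I 1+x<b (inj₂ (β , γ , α , ε , β∈P , γ∈P , β<γ , α≺ε , α<x , x<ε , ε<β)) =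
      let _ , m<α , _ = run-descent I β∈P γ∈P β<γ (proj₁ (Precedes⇒∈ α≺ε)) (<-trans α<x (<-trans x<ε ε<β))
      in <⇒≱ α<x m<α

    gap⊆R : ∀ {c b k m v} → Invariant P c b k m → m < v → v < b → v ≢ x → v ∈ R
    gap⊆R I m<v v<b v≢x = ∈R (≤-<-trans z≤n m<v) (<⇒≤ (<-≤-trans v<b (≤-trans b≤c (∈-prefix⇒≤n π≡ max∈))))
      (∉-Invariant I m<v (inj₁ v<b) (<⇒≢ (<-≤-trans v<b b≤c))) v≢x
      where open Invariant I

    -- m+1 and b−1 are both still to come: x is blocked if m+1 comes first, b−1 otherwise.
    blocked-by-bypass : ∀ {c b k m} → Invariant P c b (suc k) m → m < x → x ≢ suc m → suc x < b →
                        ¬ Unblocked P (x ∷ R)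
    blocked-by-bypass {c} {suc E} {k} {m} I m<x x≢1+m 1+x<1+E unblocked =
      [ at-x , at-E ]′ (precedes-or-follows R 1+m∈R E∈R (<⇒≢ (<-trans 1+m<x x<E)))
      where
      open Invariant I
      1+m<x : suc m < x
      1+m<x = ≤∧≢⇒< m<x (x≢1+m ∘ sym)
      x<E : x < E
      x<E = m<1+n⇒m≤n 1+x<1+E
      1+E∈P : suc E ∈ P
      1+E∈P = run⊆ ≤-refl (m<m+n (suc E) (s≤s z≤n))
      1+m∈R : suc m ∈ R
      1+m∈R = gap⊆R I (n<1+n m) (<-trans 1+m<x (<-trans x<E (n<1+n E))) (<⇒≢ 1+m<x)
      E∈R : E ∈ R
      E∈R = gap⊆R I (<-trans m<x x<E) (n<1+n E) (>⇒≢ x<E)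
      at-x : ¬ Precedes (suc m) E R
      at-x 1+m≺E = Unblocked⇒¬Blocked unblocked
        (inj₂ (suc E , c , suc m , E , 1+E∈P , max∈ , <-≤-trans (m<m+n (suc E) (s≤s z≤n)) b+k≤c ,
               1+m≺E , 1+m<x , x<E , n<1+n E))
      at-E : ¬ Precedes E (suc m) R
      at-E (R₁ , R₂ , R≡ , 1+m∈R₂) = unblocked (x ∷ R₁) E R₂ (cong (x ∷_) R≡)
        (inj₁ (x , suc E , suc m , ∈-++⁺ʳ P (here refl) , ∈-++⁺ˡ 1+E∈P , <-trans (n<1+n x) 1+x<1+E , x<E ,
               1+m∈R₂ , 1+m<x))

    blocked-by-pop : ∀ {c b k m} → Invariant P c b (suc k) m → b ≢ suc m → b < x → ¬ Unblocked P (x ∷ R)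
    blocked-by-pop {c} {b} {k} {m} I b≢1+m b<x unblocked = Unblocked⇒¬Blocked unblocked
      (inj₁ (b , c , suc m , run⊆ ≤-refl b<b+1+k , max∈ , <-≤-trans b<b+1+k b+k≤c , b<x ,
             gap⊆R I (n<1+n m) 1+m<b (<⇒≢ (<-trans 1+m<b b<x)) , 1+m<b))
      where
      open Invariant I
      b<b+1+k : b < b + suc k
      b<b+1+k = m<m+n b (s≤s z≤n)
      1+m<b : suc m < b
      1+m<b = ≤∧≢⇒< m<b (b≢1+m ∘ sym)

  Sim : List ℕ → Set
  Sim R = ∀ P c b k m → π ≡ P ++ R → Invariant P c b k m →
          psbAux (bubAux c R) (run b k) (down m) ≡ idPerm n ⇔ Unblocked P R

  via : ∀ {o o′ : List ℕ} {B : Set} → o ≡ o′ → o′ ≡ idPerm n ⇔ B → o ≡ idPerm n ⇔ B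
  via refl = id

  advance : ∀ {P x R} {o : List ℕ} → ¬ Blocked P x R →
            o ≡ idPerm n ⇔ Unblocked (P ++ [ x ]) R → o ≡ idPerm n ⇔ Unblocked P (x ∷ R)
  advance ¬blocked sim = ⇔-trans sim (Unblocked-∷ ¬blocked)

  module _ {P x R} (ih : Sim R) (π≡ : π ≡ P ++ x ∷ R) where
    open Split π≡

    open-run : ∀ {c b m} → Invariant P c b 0 m → x < c →
               psbAux (x ∷ bubAux c R) [] (down m) ≡ idPerm n ⇔ Unblocked P (x ∷ R)
    open-run {c} {b} {m} I x<c = advance (¬Blocked-empty-run π≡ I)
      (ih (P ++ [ x ]) c x 1 m ++-∷ʳ (Invariant-push (Invariant-relocate I m<1+x x<c) m<x))
      where
      m<x : m < x
      m<x = fresh⇒above-output I x∉P 0<x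
      m<1+x : m < suc x
      m<1+x = <-trans m<x (n<1+n x)

    new-max : ∀ {c b m} → Invariant P c b 0 m → c < x →
              psbAux (c ∷ bubAux x R) [] (down m) ≡ idPerm n ⇔ Unblocked P (x ∷ R)
    new-max {c} {b} {m} I c<x = advance (¬Blocked-empty-run π≡ I)
      (ih (P ++ [ x ]) x c 1 m ++-∷ʳ (Invariant-new-max I c<x))

    popping : ∀ {c b k m} t ts → Invariant P c b (suc k) m → b ≤ t → b < x →
              (Invariant P c c 0 (m + suc k) →
                 psbAux (t ∷ ts) [] (down (m + suc k)) ≡ idPerm n ⇔ Unblocked P (x ∷ R)) →
              psbAux (t ∷ ts) (run b (suc k)) (down m) ≡ idPerm n ⇔ Unblocked P (x ∷ R)
    popping {b = b} {k} {m} t ts I b≤t b<x continue with b ≟ suc m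
    ... | yes refl = via (psbAux-flush ts k m b≤t) (continue (Invariant-pop I))
    ... | no b≢1+m = ⇔-both-false wrong-output (blocked-by-pop π≡ I b≢1+m b<x)
      where
      popped : psbAux (t ∷ ts) (run b (suc k)) (down m) ≡
               psbAux ts [ t ] (reverse (run (suc b) k) ++ b ∷ down m)
      popped = trans (psbAux-pop ts (run (suc b) k) (down m) b≤t)
                     (cong (psbAux ts [ t ]) (popAll-reverse (run (suc b) k) (b ∷ down m)))
      wrong-output : psbAux (t ∷ ts) (run b (suc k)) (down m) ≢ idPerm n
      wrong-output sorted =
        b≢1+m (psbAux-next-output ts [ t ] (reverse (run (suc b) k)) m n (trans (sym popped) sorted))

    bypassing : ∀ {c b k m} → Invariant P c b (suc k) m → suc x < b →
                psbAux (x ∷ bubAux c R) (run b (suc k)) (down m) ≡ idPerm n ⇔ Unblocked P (x ∷ R)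
    bypassing {c} {b} {k} {m} I 1+x<b with x ≟ suc m
    ... | yes refl = via (psbAux-bypass (bubAux c R) (run (suc b) k) (down m) 1+x<b)
      (advance (¬Blocked-bypass π≡ refl I 1+x<b)
        (ih (P ++ [ x ]) c b (suc k) x ++-∷ʳ (Invariant-bypass I (<-trans (n<1+n x) 1+x<b))))
    ... | no x≢1+m =
      ⇔-both-false wrong-output (blocked-by-bypass π≡ I (fresh⇒above-output I x∉P 0<x) x≢1+m 1+x<b)
      where
      wrong-output : psbAux (x ∷ bubAux c R) (run b (suc k)) (down m) ≢ idPerm n
      wrong-output sorted = x≢1+m (psbAux-next-output (bubAux c R) (run b (suc k)) [] m n
        (trans (sym (psbAux-bypass (bubAux c R) (run (suc b) k) (down m) 1+x<b)) sorted))

    below : ∀ {c b k m} → Invariant P c b k m → x < c →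
            psbAux (x ∷ bubAux c R) (run b k) (down m) ≡ idPerm n ⇔ Unblocked P (x ∷ R)
    below {k = zero}  I x<c = open-run I x<c
    below {c} {b} {suc k} {m} I x<c with <-cmp (suc x) b
    ... | tri< 1+x<b _ _ = bypassing I 1+x<b
    ... | tri≈ _ refl _  = via (psbAux-push x (bubAux c R) (run (suc (suc x)) k) (down m))
      (advance (¬Blocked-push π≡ I)
        (ih (P ++ [ x ]) c x (suc (suc k)) m ++-∷ʳ (Invariant-push I (fresh⇒above-output I x∉P 0<x))))
    ... | tri> _ _ b<1+x = popping x (bubAux c R) I b≤x b<x (λ I′ → open-run I′ x<c)
      where
      b≤x : b ≤ x
      b≤x = m<1+n⇒m≤n b<1+x
      b<x : b < x
      b<x = ≤∧≢⇒< b≤x (λ { refl → x∉P (Invariant.run⊆ I ≤-refl (m<m+n b (s≤s z≤n))) })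

    above : ∀ {c b k m} → Invariant P c b k m → c < x →
            psbAux (c ∷ bubAux x R) (run b k) (down m) ≡ idPerm n ⇔ Unblocked P (x ∷ R)
    above {k = zero}  I c<x = new-max I c<x
    above {k = suc k} I c<x =
      popping _ (bubAux x R) I (Invariant.b≤c I) (≤-<-trans (Invariant.b≤c I) c<x) (λ I′ → new-max I′ c<x)

  step : ∀ {x R} → Sim R → Sim (x ∷ R)
  step {x} {R} ih P c b k m π≡ I with <-cmp x c
  ... | tri< x<c _ _  = via (cong (λ o → psbAux o (run b k) (down m)) (bubAux-< R x<c)) (below ih π≡ I x<c)
  ... | tri≈ _ refl _ = ⊥-elim (Split.x∉P π≡ (Invariant.max∈ I))
  ... | tri> _ _ c<x  =
    via (cong (λ o → psbAux o (run b k) (down m)) (bubAux-≥ R (<⇒≤ c<x))) (above ih π≡ I c<x)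

  module _ {P} (π≡ : π ≡ P ++ []) where

    complete : ∀ {v} → 0 < v → v ≤ n → v ∈ P
    complete 0<v v≤n = subst (_ ∈_) (++-identityʳ P) (subst (_ ∈_) π≡ (IsPerm⇒∈⁺ π↭ 0<v v≤n))

    run-follows-output : ∀ {c b k m} → Invariant P c b (suc k) m → b ≡ suc m
    run-follows-output {c} {b} {k} {m} I = ≤-antisym b≤1+m m<b
      where
      open Invariant I
      1+m<c : suc m < c
      1+m<c = ≤-<-trans m<b (<-≤-trans (m<m+n b (s≤s z≤n)) b+k≤c)
      b≤1+m : b ≤ suc m
      b≤1+m with classify (complete (s≤s z≤n) (<⇒≤ (<-≤-trans 1+m<c (∈-prefix⇒≤n π≡ max∈))))
      ... | inj₁ 1+m≤m               = ⊥-elim (<-irrefl refl 1+m≤m)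
      ... | inj₂ (inj₁ (b≤1+m , _)) = b≤1+m
      ... | inj₂ (inj₂ 1+m≡c)       = ⊥-elim (<-irrefl 1+m≡c 1+m<c)

    finished : ∀ {c b m} → Invariant P c b 0 m → reverse (c ∷ down m) ≡ idPerm n
    finished {c} {b} {m} I = begin
      reverse (c ∷ down m)   ≡⟨ cong (λ v → reverse (v ∷ down m)) 1+m≡c ⟨
      reverse (down (suc m)) ≡⟨ reverse-down (suc m) ⟩
      run 1 (suc m)          ≡⟨ idPerm-run (suc m) ⟨
      idPerm (suc m)         ≡⟨ cong idPerm (trans 1+m≡c (sym n≡c)) ⟩
      idPerm n               ∎
      where
      open ≡-Reasoning
      open Invariant I
      m<n : m < n
      m<n = <-≤-trans m<c (∈-prefix⇒≤n π≡ max∈)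
      only-max : ∀ {v} → m < v → v ≤ n → v ≡ c
      only-max {v} m<v v≤n with classify (complete (≤-<-trans z≤n m<v) v≤n)
      ... | inj₁ v≤m                   = ⊥-elim (<⇒≱ m<v v≤m)
      ... | inj₂ (inj₁ (b≤v , v<b+0)) = ⊥-elim (empty-run b≤v v<b+0)
      ... | inj₂ (inj₂ v≡c)           = v≡c
      1+m≡c : suc m ≡ c
      1+m≡c = only-max (n<1+n m) m<n
      n≡c : n ≡ c
      n≡c = only-max m<n ≤-refl

  end : Sim []
  end P c b zero    m π≡ I = mk⇔ (λ _ → Unblocked-[] P) (λ _ → finished π≡ I)
  end P c b (suc k) m π≡ I with run-follows-output π≡ I
  ... | refl = via (psbAux-flush [] k m (Invariant.b≤c I)) (end P c c 0 (m + suc k) π≡ (Invariant-pop I))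

  simulate : ∀ R → Sim R
  simulate []      = end
  simulate (x ∷ R) = step (simulate R)


-- Blocked entries are the occurrences of the six patterns

⊆-split : ∀ xs {y : ℕ} {ys L} → (xs ++ y ∷ ys) ⊆ L →
          ∃[ L₁ ] ∃[ L₂ ] (L ≡ L₁ ++ y ∷ L₂ × xs ⊆ L₁ × ys ⊆ L₂)
⊆-split []       (refl ∷ τ) = [] , _ , refl , [] , τ
⊆-split []       (z ∷ʳ τ) with ⊆-split [] τ
... | L₁ , L₂ , refl , σ , ρ = z ∷ L₁ , L₂ , refl , z ∷ʳ σ , ρ
⊆-split (x ∷ xs) (z ∷ʳ τ) with ⊆-split (x ∷ xs) τ
... | L₁ , L₂ , refl , σ , ρ = z ∷ L₁ , L₂ , refl , z ∷ʳ σ , ρ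
⊆-split (x ∷ xs) (refl ∷ τ) with ⊆-split xs τ
... | L₁ , L₂ , refl , σ , ρ = x ∷ L₁ , L₂ , refl , refl ∷ σ , ρ

⊆⇒Precedes : ∀ {u w L} → (u ∷ w ∷ []) ⊆ L → Precedes u w L
⊆⇒Precedes τ with ⊆-split [] τ
... | L₁ , L₂ , eq , _ , σ = L₁ , L₂ , eq , lookup σ (here refl)

Precedes⇒⊆ : ∀ {u w L} → Precedes u w L → (u ∷ w ∷ []) ⊆ L
Precedes⇒⊆ (A , B , refl , w∈B) = ++⁺ (minimum A) (refl ∷ from∈ w∈B)

SomeBlocked : List ℕ → Set
SomeBlocked π = ∃[ R₁ ] ∃[ x ] ∃[ R₂ ] (π ≡ R₁ ++ x ∷ R₂ × Blocked R₁ x R₂)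

Unblocked-[]⇔¬SomeBlocked : ∀ {π} → Unblocked [] π ⇔ (¬ SomeBlocked π)
Unblocked-[]⇔¬SomeBlocked = mk⇔ (λ { unblocked (R₁ , x , R₂ , π≡ , blocked) → unblocked R₁ x R₂ π≡ blocked })
                                 (λ ¬blocked R₁ x R₂ π≡ blocked → ¬blocked (R₁ , x , R₂ , π≡ , blocked))

Agree : ℕ → ℕ → ℕ → ℕ → Set
Agree x y p q = (x < y ⇔ p < q) × (y < x ⇔ q < p)

-- The T-arguments reduce to ⊤, and are found by Agda, whenever p and q are numerals.
agree-< : ∀ {x y p q} {_ : T (p <ᵇ q)} → x < y → Agree x y p q
agree-< {p = p} {q} {p<q} x<y =
  mk⇔ (λ _ → <ᵇ⇒< p q p<q) (λ _ → x<y) ,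
  mk⇔ (λ y<x → ⊥-elim (<-asym x<y y<x)) (λ q<p → ⊥-elim (<-asym (<ᵇ⇒< p q p<q) q<p))

agree-> : ∀ {x y p q} {_ : T (q <ᵇ p)} → y < x → Agree x y p q
agree-> {p = p} {q} {q<p} y<x =
  mk⇔ (λ x<y → ⊥-elim (<-asym x<y y<x)) (λ p<q → ⊥-elim (<-asym (<ᵇ⇒< q p q<p) p<q)) ,
  mk⇔ (λ _ → <ᵇ⇒< q p q<p) (λ _ → y<x)

agree⇒< : ∀ {x y p q} → T (p <ᵇ q) → Agree x y p q → x < y
agree⇒< {p = p} {q} p<q (x<y⇔p<q , _) = Equivalence.from x<y⇔p<q (<ᵇ⇒< p q p<q)

agree⇒> : ∀ {x y p q} → T (q <ᵇ p) → Agree x y p q → y < x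
agree⇒> {p = p} {q} q<p (_ , y<x⇔q<p) = Equivalence.from y<x⇔q<p (<ᵇ⇒< q p q<p)

occurrence₄ : ∀ {π p q r s} → Contains π (p ∷ q ∷ r ∷ s ∷ []) →
  ∃[ a ] ∃[ b ] ∃[ c ] ∃[ d ] ((a ∷ b ∷ c ∷ d ∷ []) ⊆ π × OrdIso (a ∷ b ∷ c ∷ d ∷ []) (p ∷ q ∷ r ∷ s ∷ []))
occurrence₄ ((a ∷ b ∷ c ∷ d ∷ []) , τ , iso) = a , b , c , d , τ , iso
occurrence₄ ([] , _ , ())
occurrence₄ ((_ ∷ []) , _ , () , _)
occurrence₄ ((_ ∷ _ ∷ []) , _ , (_ ∷ ()) , _)
occurrence₄ ((_ ∷ _ ∷ _ ∷ []) , _ , (_ ∷ _ ∷ ()) , _)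
occurrence₄ ((_ ∷ _ ∷ _ ∷ _ ∷ _ ∷ _) , _ , (_ ∷ _ ∷ _ ∷ ()) , _)

occurrence₅ : ∀ {π p q r s t} → Contains π (p ∷ q ∷ r ∷ s ∷ t ∷ []) →
  ∃[ a ] ∃[ b ] ∃[ c ] ∃[ d ] ∃[ e ]
    ((a ∷ b ∷ c ∷ d ∷ e ∷ []) ⊆ π × OrdIso (a ∷ b ∷ c ∷ d ∷ e ∷ []) (p ∷ q ∷ r ∷ s ∷ t ∷ []))
occurrence₅ ((a ∷ b ∷ c ∷ d ∷ e ∷ []) , τ , iso) = a , b , c , d , e , τ , iso
occurrence₅ ([] , _ , ())
occurrence₅ ((_ ∷ []) , _ , () , _)
occurrence₅ ((_ ∷ _ ∷ []) , _ , (_ ∷ ()) , _)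
occurrence₅ ((_ ∷ _ ∷ _ ∷ []) , _ , (_ ∷ _ ∷ ()) , _)
occurrence₅ ((_ ∷ _ ∷ _ ∷ _ ∷ []) , _ , (_ ∷ _ ∷ _ ∷ ()) , _)
occurrence₅ ((_ ∷ _ ∷ _ ∷ _ ∷ _ ∷ _ ∷ _) , _ , (_ ∷ _ ∷ _ ∷ _ ∷ ()) , _)

SomeBlocked-at₄ : ∀ {π a b c d} → (a ∷ b ∷ c ∷ d ∷ []) ⊆ π →
                  (∀ {R₁ R₂} → a ∈ R₁ → b ∈ R₁ → d ∈ R₂ → Blocked R₁ c R₂) → SomeBlocked π
SomeBlocked-at₄ τ blocked with ⊆-split (_ ∷ _ ∷ []) τ
... | R₁ , R₂ , π≡ , σ , ρ =
  R₁ , _ , R₂ , π≡ , blocked (lookup σ (here refl)) (lookup σ (there (here refl))) (lookup ρ (here refl))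

SomeBlocked-at₅ : ∀ {π a b c d e} → (a ∷ b ∷ c ∷ d ∷ e ∷ []) ⊆ π →
                  (∀ {R₁ R₂} → a ∈ R₁ → b ∈ R₁ → Precedes d e R₂ → Blocked R₁ c R₂) → SomeBlocked π
SomeBlocked-at₅ τ blocked with ⊆-split (_ ∷ _ ∷ []) τ
... | R₁ , R₂ , π≡ , σ , ρ =
  R₁ , _ , R₂ , π≡ , blocked (lookup σ (here refl)) (lookup σ (there (here refl))) (⊆⇒Precedes ρ)

module _ {π : List ℕ} where

  βγxα⇒SomeBlocked : ∀ {p q r s} {p<q : T (p <ᵇ q)} {p<r : T (p <ᵇ r)} {s<p : T (s <ᵇ p)} →
                     Contains π (p ∷ q ∷ r ∷ s ∷ []) → SomeBlocked π
  βγxα⇒SomeBlocked {p<q = p<q} {p<r} {s<p} occ with occurrence₄ occ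
  ... | _ , _ , _ , _ , τ , (ab ∷ ac ∷ ad ∷ []) , _ = SomeBlocked-at₄ τ λ a∈ b∈ d∈ →
    inj₁ (_ , _ , _ , a∈ , b∈ , agree⇒< p<q ab , agree⇒< p<r ac , d∈ , agree⇒> s<p ad)

  γβxα⇒SomeBlocked : ∀ {p q r s} {q<p : T (q <ᵇ p)} {q<r : T (q <ᵇ r)} {s<q : T (s <ᵇ q)} →
                     Contains π (p ∷ q ∷ r ∷ s ∷ []) → SomeBlocked π
  γβxα⇒SomeBlocked {q<p = q<p} {q<r} {s<q} occ with occurrence₄ occ
  ... | _ , _ , _ , _ , τ , (ab ∷ _ ∷ _ ∷ []) , (bc ∷ bd ∷ []) , _ = SomeBlocked-at₄ τ λ a∈ b∈ d∈ →
    inj₁ (_ , _ , _ , b∈ , a∈ , agree⇒> q<p ab , agree⇒< q<r bc , d∈ , agree⇒> s<q bd)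

  βγxαε⇒SomeBlocked : ∀ {p q r s t}
                      {p<q : T (p <ᵇ q)} {s<r : T (s <ᵇ r)} {r<t : T (r <ᵇ t)} {t<p : T (t <ᵇ p)} →
                      Contains π (p ∷ q ∷ r ∷ s ∷ t ∷ []) → SomeBlocked π
  βγxαε⇒SomeBlocked {p<q = p<q} {s<r} {r<t} {t<p} occ with occurrence₅ occ
  ... | _ , _ , _ , _ , _ , τ , (ab ∷ _ ∷ _ ∷ ae ∷ []) , _ , (cd ∷ ce ∷ []) , _ =
    SomeBlocked-at₅ τ λ a∈ b∈ d≺e →
      inj₂ (_ , _ , _ , _ , a∈ , b∈ , agree⇒< p<q ab , d≺e , agree⇒> s<r cd , agree⇒< r<t ce , agree⇒> t<p ae)

  γβxαε⇒SomeBlocked : ∀ {p q r s t}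
                      {q<p : T (q <ᵇ p)} {s<r : T (s <ᵇ r)} {r<t : T (r <ᵇ t)} {t<q : T (t <ᵇ q)} →
                      Contains π (p ∷ q ∷ r ∷ s ∷ t ∷ []) → SomeBlocked π
  γβxαε⇒SomeBlocked {q<p = q<p} {s<r} {r<t} {t<q} occ with occurrence₅ occ
  ... | _ , _ , _ , _ , _ , τ , (ab ∷ _ ∷ _ ∷ _ ∷ []) , (_ ∷ _ ∷ be ∷ []) , (cd ∷ ce ∷ []) , _ =
    SomeBlocked-at₅ τ λ a∈ b∈ d≺e →
      inj₂ (_ , _ , _ , _ , b∈ , a∈ , agree⇒> q<p ab , d≺e , agree⇒> s<r cd , agree⇒< r<t ce , agree⇒> t<q be)

patterns : List (List ℕ)
patterns = (2 ∷ 3 ∷ 4 ∷ 1 ∷ []) ∷ (2 ∷ 4 ∷ 3 ∷ 1 ∷ []) ∷ (3 ∷ 2 ∷ 4 ∷ 1 ∷ []) ∷ (4 ∷ 2 ∷ 3 ∷ 1 ∷ [])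
         ∷ (4 ∷ 5 ∷ 2 ∷ 1 ∷ 3 ∷ []) ∷ (5 ∷ 4 ∷ 2 ∷ 1 ∷ 3 ∷ []) ∷ []

¬SomeBlocked⇒Avoids : ∀ {π} → ¬ SomeBlocked π → Avoids patterns π
¬SomeBlocked⇒Avoids ¬blocked =
    ¬blocked ∘ βγxα⇒SomeBlocked ∷ ¬blocked ∘ βγxα⇒SomeBlocked
  ∷ ¬blocked ∘ γβxα⇒SomeBlocked ∷ ¬blocked ∘ γβxα⇒SomeBlocked
  ∷ ¬blocked ∘ βγxαε⇒SomeBlocked ∷ ¬blocked ∘ γβxαε⇒SomeBlocked ∷ []

occurs₄ : ∀ {π R₁ x R₂ u w α} → π ≡ R₁ ++ x ∷ R₂ → Precedes u w R₁ → α ∈ R₂ → (u ∷ w ∷ x ∷ α ∷ []) ⊆ π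
occurs₄ refl u≺w α∈ = ++⁺ (Precedes⇒⊆ u≺w) (refl ∷ from∈ α∈)

occurs₅ : ∀ {π R₁ x R₂ u w α ε} → π ≡ R₁ ++ x ∷ R₂ → Precedes u w R₁ → Precedes α ε R₂ →
          (u ∷ w ∷ x ∷ α ∷ ε ∷ []) ⊆ π
occurs₅ refl u≺w α≺ε = ++⁺ (Precedes⇒⊆ u≺w) (refl ∷ Precedes⇒⊆ α≺ε)

Blocked₄⇒¬Avoids : ∀ {π R₁ x R₂} → Unique π → π ≡ R₁ ++ x ∷ R₂ → Blocked₄ R₁ x R₂ → ¬ Avoids patterns π
Blocked₄⇒¬Avoids {R₁ = R₁} {x} π-unique π≡ (β , γ , α , β∈ , γ∈ , β<γ , β<x , α∈ , α<β)
                 (¬2341 ∷ ¬2431 ∷ ¬3241 ∷ ¬4231 ∷ _) =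
  [ β-first , γ-first ]′ (precedes-or-follows R₁ β∈ γ∈ (<⇒≢ β<γ))
  where
  α<γ = <-trans α<β β<γ
  α<x = <-trans α<β β<x
  γ≢x : γ ≢ x
  γ≢x refl = Unique-++-disjoint R₁ (subst Unique π≡ π-unique) γ∈ (here refl)
  β-first : ¬ Precedes β γ R₁
  β-first β≺γ with <-cmp γ x
  ... | tri< γ<x _ _ = ¬2341 (_ , occurs₄ π≡ β≺γ α∈ ,
        (agree-< β<γ ∷ agree-< β<x ∷ agree-> α<β ∷ []) ,
        (agree-< γ<x ∷ agree-> α<γ ∷ []) , (agree-> α<x ∷ []) , [] , _)
  ... | tri≈ _ γ≡x _ = γ≢x γ≡x
  ... | tri> _ _ x<γ = ¬2431 (_ , occurs₄ π≡ β≺γ α∈ ,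
        (agree-< β<γ ∷ agree-< β<x ∷ agree-> α<β ∷ []) ,
        (agree-> x<γ ∷ agree-> α<γ ∷ []) , (agree-> α<x ∷ []) , [] , _)
  γ-first : ¬ Precedes γ β R₁
  γ-first γ≺β with <-cmp γ x
  ... | tri< γ<x _ _ = ¬3241 (_ , occurs₄ π≡ γ≺β α∈ ,
        (agree-> β<γ ∷ agree-< γ<x ∷ agree-> α<γ ∷ []) ,
        (agree-< β<x ∷ agree-> α<β ∷ []) , (agree-> α<x ∷ []) , [] , _)
  ... | tri≈ _ γ≡x _ = γ≢x γ≡x
  ... | tri> _ _ x<γ = ¬4231 (_ , occurs₄ π≡ γ≺β α∈ ,
        (agree-> β<γ ∷ agree-> x<γ ∷ agree-> α<γ ∷ []) ,
        (agree-< β<x ∷ agree-> α<β ∷ []) , (agree-> α<x ∷ []) , [] , _)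

Blocked₅⇒¬Avoids : ∀ {π R₁ x R₂} → π ≡ R₁ ++ x ∷ R₂ → Blocked₅ R₁ x R₂ → ¬ Avoids patterns π
Blocked₅⇒¬Avoids {R₁ = R₁} π≡ (β , γ , α , ε , β∈ , γ∈ , β<γ , α≺ε , α<x , x<ε , ε<β)
                 (_ ∷ _ ∷ _ ∷ _ ∷ ¬45213 ∷ ¬54213 ∷ _) =
  [ β-first , γ-first ]′ (precedes-or-follows R₁ β∈ γ∈ (<⇒≢ β<γ))
  where
  x<β = <-trans x<ε ε<β
  α<β = <-trans α<x x<β
  x<γ = <-trans x<β β<γ
  α<γ = <-trans α<β β<γ
  ε<γ = <-trans ε<β β<γ
  α<ε = <-trans α<x x<ε
  β-first : ¬ Precedes β γ R₁
  β-first β≺γ = ¬45213 (_ , occurs₅ π≡ β≺γ α≺ε ,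
    (agree-< β<γ ∷ agree-> x<β ∷ agree-> α<β ∷ agree-> ε<β ∷ []) ,
    (agree-> x<γ ∷ agree-> α<γ ∷ agree-> ε<γ ∷ []) ,
    (agree-> α<x ∷ agree-< x<ε ∷ []) , (agree-< α<ε ∷ []) , [] , _)
  γ-first : ¬ Precedes γ β R₁
  γ-first γ≺β = ¬54213 (_ , occurs₅ π≡ γ≺β α≺ε ,
    (agree-> β<γ ∷ agree-> x<γ ∷ agree-> α<γ ∷ agree-> ε<γ ∷ []) ,
    (agree-> x<β ∷ agree-> α<β ∷ agree-> ε<β ∷ []) ,
    (agree-> α<x ∷ agree-< x<ε ∷ []) , (agree-< α<ε ∷ []) , [] , _)

Avoids⇒¬SomeBlocked : ∀ {π} → Unique π → Avoids patterns π → ¬ SomeBlocked π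
Avoids⇒¬SomeBlocked π-unique avoids (_ , _ , _ , π≡ , inj₁ blocked) =
  Blocked₄⇒¬Avoids π-unique π≡ blocked avoids
Avoids⇒¬SomeBlocked π-unique avoids (_ , _ , _ , π≡ , inj₂ blocked) =
  Blocked₅⇒¬Avoids π≡ blocked avoids

psb-bub-sorts⇔Unblocked : ∀ n π → IsPerm n π → psb (bub π) ≡ idPerm n ⇔ Unblocked [] π
psb-bub-sorts⇔Unblocked zero    [] _  = mk⇔ (λ _ → Unblocked-[] []) (λ _ → refl)
psb-bub-sorts⇔Unblocked (suc n) [] π↭ with IsPerm⇒∈⁺ π↭ (s≤s z≤n) (s≤s z≤n)
... | ()
psb-bub-sorts⇔Unblocked n (c ∷ R) π↭ =
  ⇔-trans (simulate R [ c ] c c 0 0 refl (Invariant-start (proj₁ (IsPerm⇒∈⁻ π↭ (here refl)))))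
          (Unblocked-∷ ¬Blocked-[])
  where open Simulation π↭

mainTheorem20 : (n : ℕ) (π : List ℕ) → IsPerm n π →
    (psb (bub π) ≡ idPerm n ⇔
      Avoids ((2 ∷ 3 ∷ 4 ∷ 1 ∷ []) ∷ (2 ∷ 4 ∷ 3 ∷ 1 ∷ []) ∷ (3 ∷ 2 ∷ 4 ∷ 1 ∷ []) ∷ (4 ∷ 2 ∷ 3 ∷ 1 ∷ [])
        ∷ (4 ∷ 5 ∷ 2 ∷ 1 ∷ 3 ∷ []) ∷ (5 ∷ 4 ∷ 2 ∷ 1 ∷ 3 ∷ []) ∷ []) π)
mainTheorem20 n π π↭ =
  ⇔-trans (psb-bub-sorts⇔Unblocked n π π↭)
  (⇔-trans Unblocked-[]⇔¬SomeBlocked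
           (mk⇔ ¬SomeBlocked⇒Avoids (Avoids⇒¬SomeBlocked (IsPerm⇒Unique π↭))))
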